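{- Let $G$ be a cycle and $\mathcal{H}$ a $2$-fold cover of $G$. Then $\mathcal{H}$ has a twisted-canonical labeling if and only if $\mathcal{H}$ is full and has no canonical labeling.
   Context: A cover of a graph $G$ is a pair $\mathcal{H}=(L,H)$ with $H$ a graph and $L:V(G)\to\mathcal{P}(V(H))$ such that $\{L(v)\}$ partitions $V(H)$ into $|V(G)|$ parts, each $H[L(v)]$ is complete, edges of $H$ between distinct $L(u),L(v)$ occur only if $uv\in E(G)$, and for $uv\in E(G)$ these edges form a (possibly empty) matching; it is $k$-fold if all $|L(v)|=k$, and full if for every $uv\in E(G)$ the matching between $L(u)$ and $L(v)$ is perfect. A $k$-fold cover has a canonical labeling if one can write $L(v)=\{(v,j):j\in[k]\}$ so that whenever $uv\in E(G)$, $(u,j)(v,j)\in E(H)$ for all $j\in[k]$. A $k$-fold cover has a twisted-canonical labeling if it is full and one can write $L(v)=\{(v,j):j\in[k]\}$ for each $v$ and choose an edge $uv\in E(G)$ so that for every $xy\in E(G)\setminus\{uv\}$, $(x,j)(y,j)\in E(H)$ for all $j\in[k]$, and there exists $l\in[k]$ with $(u,l)(v,l)\notin E(H)$. -}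

module Defs where

open import Level using (Level; 0ℓ) renaming (suc to lsuc)
open import Data.Nat using (ℕ; zero; suc; _≤_)
open import Data.Fin using (Fin; toℕ)
open import Data.Product using (Σ; ∃; _×_; _,_; proj₁)
open import Data.Sum using (_⊎_)
open import Relation.Nullary using (¬_)
open import Relation.Binary.PropositionalEquality using (_≡_; _≢_)
open import Function.Bundles using (_⤖_; _⇔_; Bijection)

record Graph (n : ℕ) : Set₁ where
  field
    Adj    : Fin n → Fin n → Set
    sym    : ∀ {u v} → Adj u v → Adj v u
    irrefl : ∀ {u} → ¬ Adj u u
open Graph public

CycAdj : (n : ℕ) → Fin n → Fin n → Set
CycAdj n i j =
  (suc (toℕ i) ≡ toℕ j) ⊎ (suc (toℕ j) ≡ toℕ i)
  ⊎ ((toℕ i ≡ 0 × suc (toℕ j) ≡ n) ⊎ (toℕ j ≡ 0 × suc (toℕ i) ≡ n))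

IsCycle : ∀ {n} → Graph n → Set
IsCycle {n} G = 3 ≤ n × Σ (Fin n ⤖ Fin n) λ σ →
  ∀ u v → Adj G u v ⇔ CycAdj n (Bijection.to σ u) (Bijection.to σ v)

-- A cover (L, H) of G.  V(H) = Fin m; the partition {L(v)} of V(H) is given
-- by the map part : V(H) → V(G), with L(v) = part⁻¹(v).
record Cover {n : ℕ} (G : Graph n) : Set₁ where
  field
    m     : ℕ
    H     : Graph m
    part  : Fin m → Fin n
    clique   : ∀ x y → part x ≡ part y → x ≢ y → Adj H x y
    cross    : ∀ x y → Adj H x y → part x ≢ part y → Adj G (part x) (part y)
    matching : ∀ x y y' → part x ≢ part y → part y ≡ part y' →
               Adj H x y → Adj H x y' → y ≡ y'
open Cover public

module _ {n : ℕ} {G : Graph n} (C : Cover G) where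

  Fiber : Fin n → Set
  Fiber v = Σ (Fin (m C)) λ x → part C x ≡ v

  IsKFold : ℕ → Set
  IsKFold k = ∀ v → Fin k ⤖ Fiber v

  -- full: for every uv ∈ E(G) the matching between L(u) and L(v) is perfect
  -- (stated for both orientations since uv and vu both range over E(G))
  IsFull : Set
  IsFull = ∀ u v → Adj G u v →
    ∀ x → part C x ≡ u → ∃ λ y → part C y ≡ v × Adj (H C) x y

  Labeling : ℕ → Set
  Labeling k = ∀ v → Fin k ⤖ Fiber v

  at : ∀ {k} → Labeling k → Fin n → Fin k → Fin (m C)
  at ℓ v j = proj₁ (Bijection.to (ℓ v) j)

  HasCanonicalLabeling : ℕ → Set
  HasCanonicalLabeling k = Σ (Labeling k) λ ℓ →
    ∀ u v → Adj G u v → ∀ j → Adj (H C) (at ℓ u j) (at ℓ v j)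

  HasTwistedCanonicalLabeling : ℕ → Set
  HasTwistedCanonicalLabeling k = IsFull × Σ (Labeling k) λ ℓ →
    Σ (Fin n) λ u → Σ (Fin n) λ v → Adj G u v ×
      (∀ x y → Adj G x y → ¬ ((x ≡ u × y ≡ v) ⊎ (x ≡ v × y ≡ u)) →
         ∀ j → Adj (H C) (at ℓ x j) (at ℓ y j)) ×
      (∃ λ l → ¬ Adj (H C) (at ℓ u l) (at ℓ v l))

-- In a full 2-fold cover every edge uv is, for a given labelling, either straight
-- ((u,j) ~ (v,j) for all j) or crossed ((u,j) ~ (v,1-j) for all j).  If ℓ crosses only the
-- edge from u to its cyclic successor and ℓ′ is canonical, the ℓ-label of ℓ′(x,0) stays
-- constant along the Hamiltonian path left by deleting that edge, but flips across it.
-- Conversely, lift the Hamiltonian path through the perfect matchings and relabel each fibre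
-- so that the lift has label 0: every path edge becomes straight, and the closing edge must
-- be crossed, for otherwise the labelling would be canonical.

module Submission where

open import Defs hiding (sym)
open import Data.Nat using (ℕ; zero; suc; _≤_; _<_; z≤n; s≤s)
open import Data.Nat.Properties
  using (≤-refl; ≤-trans; <⇒≤; <⇒≢; >⇒≢; ≤-pred; m≤n⇒m<n∨m≡n; m≤n⇒m≤1+n; suc-injective)
open import Data.Nat.DivMod using (_%_; _mod_; m≤n⇒m%n≡m; n%n≡0)
open import Data.Fin using (Fin; toℕ; opposite)
open import Data.Fin.Properties using (0≢1+n; toℕ<n; toℕ-fromℕ<; toℕ-injective; _≟_)
open import Data.Fin.Patterns using (0F; 1F)
open import Data.Fin.Permutation using (transpose)
open import Data.Product using (_×_; _,_; proj₁; proj₂)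
open import Data.Sum using (_⊎_; inj₁; inj₂)
open import Data.Empty using (⊥-elim)
open import Relation.Nullary using (¬_; yes; no)
open import Relation.Binary.PropositionalEquality
  using (_≡_; _≢_; refl; sym; trans; cong; subst; subst₂; module ≡-Reasoning)
open import Function.Bundles using (_⤖_; _⇔_; Bijection; Equivalence; Surjection; mk⇔)
open import Function.Construct.Composition using (_⤖-∘_)
open import Function.Properties.Inverse using (↔⇒⤖)
open import Axiom.UniquenessOfIdentityProofs using (module Decidable⇒UIP)

open Bijection using (to; to⁻)

to∘to⁻ : ∀ {A B : Set} (f : A ⤖ B) y → to f (to⁻ f y) ≡ y
to∘to⁻ f = Surjection.to∘to⁻ (Bijection.surjection f)

≡-along : ∀ {A : Set} (g : ℕ → A) {a b} → a ≤ b →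
          (∀ {k} → a ≤ k → k < b → g k ≡ g (suc k)) → g a ≡ g b
≡-along g {b = zero} z≤n step = refl
≡-along g {b = suc b} a≤b+1 step with m≤n⇒m<n∨m≡n a≤b+1
... | inj₂ refl = refl
... | inj₁ (s≤s a≤b) =
  trans (≡-along g a≤b (λ a≤k k<b → step a≤k (m≤n⇒m≤1+n k<b))) (step a≤b ≤-refl)

opposite-≢ : ∀ (j : Fin 2) → j ≢ opposite j
opposite-≢ 0F ()
opposite-≢ 1F ()

injective-Fin2 : (f : Fin 2 → Fin 2) → f 0F ≢ f 1F →
                 (∀ j → f j ≡ j) ⊎ (∀ j → f j ≡ opposite j)
injective-Fin2 f f0≢f1 with f 0F in e0 | f 1F in e1
... | 0F | 0F = ⊥-elim (f0≢f1 refl)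
... | 0F | 1F = inj₁ λ { 0F → e0 ; 1F → e1 }
... | 1F | 0F = inj₂ λ { 0F → e0 ; 1F → e1 }
... | 1F | 1F = ⊥-elim (f0≢f1 refl)

SameEdge : ∀ {n} → Fin n → Fin n → Fin n → Fin n → Set
SameEdge x y u v = (x ≡ u × y ≡ v) ⊎ (x ≡ v × y ≡ u)

SameEdge-symˡ : ∀ {n} {x y u v : Fin n} → SameEdge x y u v → SameEdge y x u v
SameEdge-symˡ (inj₁ (x≡u , y≡v)) = inj₂ (y≡v , x≡u)
SameEdge-symˡ (inj₂ (x≡v , y≡u)) = inj₁ (y≡u , x≡v)

SameEdge-symʳ : ∀ {n} {x y u v : Fin n} → SameEdge x y u v → SameEdge x y v u
SameEdge-symʳ (inj₁ p) = inj₂ p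
SameEdge-symʳ (inj₂ p) = inj₁ p

module CycleOrder {n : ℕ} (G : Graph (suc n)) (σ : Fin (suc n) ⤖ Fin (suc n))
  (iso : ∀ u v → Adj G u v ⇔ CycAdj (suc n) (to σ u) (to σ v)) where

  pos : Fin (suc n) → ℕ
  pos x = toℕ (to σ x)

  pos-injective : ∀ {x y} → pos x ≡ pos y → x ≡ y
  pos-injective e = Bijection.injective σ (toℕ-injective e)

  pos≤n : ∀ x → pos x ≤ n
  pos≤n x = ≤-pred (toℕ<n (to σ x))

  pos-to⁻ : ∀ i → pos (to⁻ σ i) ≡ toℕ i
  pos-to⁻ i = cong toℕ (to∘to⁻ σ i)

  succ : Fin (suc n) → Fin (suc n)
  succ x = to⁻ σ (suc (pos x) mod suc n)

  pos-succ-mod : ∀ x → pos (succ x) ≡ suc (pos x) % suc n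
  pos-succ-mod x = trans (pos-to⁻ _) (toℕ-fromℕ< _)

  pos-succ : ∀ {x} → pos x < n → pos (succ x) ≡ suc (pos x)
  pos-succ {x} lt = trans (pos-succ-mod x) (m≤n⇒m%n≡m lt)

  pos-succ-last : ∀ {x} → pos x ≡ n → pos (succ x) ≡ 0
  pos-succ-last {x} e =
    trans (pos-succ-mod x) (trans (cong (λ p → suc p % suc n) e) (n%n≡0 (suc n)))

  succ-adj : ∀ x → Adj G x (succ x)
  succ-adj x = Equivalence.from (iso x (succ x)) (cycAdj (m≤n⇒m<n∨m≡n (pos≤n x)))
    where
      cycAdj : pos x < n ⊎ pos x ≡ n → CycAdj (suc n) (to σ x) (to σ (succ x))
      cycAdj (inj₁ lt) = inj₁ (sym (pos-succ lt))
      cycAdj (inj₂ e) = inj₂ (inj₂ (inj₂ (pos-succ-last e , cong suc e)))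

  succ-from-pos : ∀ {x y} → suc (pos x) ≡ pos y ⊎ (pos y ≡ 0 × suc (pos x) ≡ suc n) → y ≡ succ x
  succ-from-pos {x} {y} (inj₁ e) = pos-injective (trans (sym e) (sym (pos-succ lt)))
    where
      lt : pos x < n
      lt = subst (_≤ n) (sym e) (pos≤n y)
  succ-from-pos (inj₂ (y₀ , x-last)) =
    pos-injective (trans y₀ (sym (pos-succ-last (suc-injective x-last))))

  adj⇒succ : ∀ {x y} → Adj G x y → y ≡ succ x ⊎ x ≡ succ y
  adj⇒succ {x} {y} a with Equivalence.to (iso x y) a
  ... | inj₁ e = inj₁ (succ-from-pos (inj₁ e))
  ... | inj₂ (inj₁ e) = inj₂ (succ-from-pos (inj₁ e))
  ... | inj₂ (inj₂ (inj₁ e)) = inj₂ (succ-from-pos (inj₂ e))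
  ... | inj₂ (inj₂ (inj₂ e)) = inj₁ (succ-from-pos (inj₂ e))

  adj-by-succ : (P : Fin (suc n) → Fin (suc n) → Set) → (∀ {x y} → P x y → P y x) →
                (∀ x → P x (succ x)) → ∀ {x y} → Adj G x y → P x y
  adj-by-succ P P-sym P-succ a with adj⇒succ a
  ... | inj₁ refl = P-succ _
  ... | inj₂ refl = P-sym (P-succ _)

  succ∘succ≢id : 2 ≤ n → ∀ x → succ (succ x) ≢ x
  succ∘succ≢id 2≤n x e with m≤n⇒m<n∨m≡n (pos≤n x)
  ... | inj₂ x-last = <⇒≢ 2≤n (trans (sym ss-one) (trans (cong pos e) x-last))
    where
      s-zero : pos (succ x) ≡ 0
      s-zero = pos-succ-last x-last
      ss-one : pos (succ (succ x)) ≡ 1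
      ss-one = trans (pos-succ {succ x} (subst (_< n) (sym s-zero) (≤-trans (s≤s z≤n) 2≤n)))
                     (cong suc s-zero)
  ... | inj₁ lt with m≤n⇒m<n∨m≡n (subst (_≤ n) (sym (pos-succ lt)) lt)
  ...   | inj₁ lt′ = >⇒≢ (m≤n⇒m≤1+n ≤-refl)
                       (trans (sym (trans (pos-succ lt′) (cong suc (pos-succ lt)))) (cong pos e))
  ...   | inj₂ next-last =
          <⇒≢ 2≤n (trans (sym (cong suc x-first)) (trans (sym (pos-succ lt)) next-last))
    where
      x-first : pos x ≡ 0
      x-first = trans (sym (cong pos e)) (pos-succ-last next-last)

  walk : ℕ → Fin (suc n)
  walk zero = to⁻ σ 0F
  walk (suc k) = succ (walk k)

  pos-walk : ∀ {k} → k ≤ n → pos (walk k) ≡ k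
  pos-walk {zero} _ = pos-to⁻ 0F
  pos-walk {suc k} k<n = trans (pos-succ (subst (_< n) (sym ih) k<n)) (cong suc ih)
    where
      ih : pos (walk k) ≡ k
      ih = pos-walk (<⇒≤ k<n)

  walk-pos : ∀ x → walk (pos x) ≡ x
  walk-pos x = pos-injective (pos-walk (pos≤n x))

  walk-wrap : walk (suc n) ≡ walk zero
  walk-wrap = pos-injective (trans (pos-succ-last (pos-walk ≤-refl)) (sym (pos-walk z≤n)))

  -- Removing the edge from u to succ u leaves a Hamiltonian path from succ u round to u.
  succ-cut : ∀ {A : Set} (f : Fin (suc n) → A) u →
             (∀ x → x ≢ u → f x ≡ f (succ x)) → f u ≡ f (succ u)
  succ-cut {A} f u step = begin
    f u                ≡⟨ cong f (sym (walk-pos u)) ⟩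
    f (walk (pos u))   ≡⟨ sym (≡-along along z≤n λ _ k<p →
                              step′ (≤-trans (<⇒≤ k<p) (pos≤n u)) (<⇒≢ k<p)) ⟩
    f (walk zero)      ≡⟨ cong f (sym walk-wrap) ⟩
    f (walk (suc n))   ≡⟨ sym (≡-along along (s≤s (pos≤n u)) λ p<k k<n →
                              step′ (≤-pred k<n) (>⇒≢ p<k)) ⟩
    f (walk (suc (pos u))) ≡⟨ cong (λ x → f (succ x)) (walk-pos u) ⟩
    f (succ u)         ∎
    where
      open ≡-Reasoning
      along : ℕ → A
      along k = f (walk k)
      step′ : ∀ {k} → k ≤ n → k ≢ pos u → f (walk k) ≡ f (walk (suc k))
      step′ k≤n k≢p = step _ (λ e → k≢p (trans (sym (pos-walk k≤n)) (cong pos e)))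

module CoverLabelling {n : ℕ} {G : Graph n} (C : Cover G) where

  private
    AdjH = Adj (H C)

  Straight : ∀ {k} → Labeling C k → Fin n → Fin n → Set
  Straight ℓ u v = ∀ j → AdjH (at C ℓ u j) (at C ℓ v j)

  Crossed : Labeling C 2 → Fin n → Fin n → Set
  Crossed ℓ u v = ∀ j → AdjH (at C ℓ u j) (at C ℓ v (opposite j))

  Straight-sym : ∀ {k} (ℓ : Labeling C k) {u v} → Straight ℓ u v → Straight ℓ v u
  Straight-sym ℓ st j = Graph.sym (H C) (st j)

  part-at : ∀ {k} (ℓ : Labeling C k) v j → part C (at C ℓ v j) ≡ v
  part-at ℓ v j = proj₂ (to (ℓ v) j)

  at-injective : ∀ {k} (ℓ : Labeling C k) v {i j} → at C ℓ v i ≡ at C ℓ v j → i ≡ j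
  at-injective ℓ v e = Bijection.injective (ℓ v) (fiber-≡ e)
    where
      fiber-≡ : ∀ {a b : Fiber C v} → proj₁ a ≡ proj₁ b → a ≡ b
      fiber-≡ {x , p} {.x , q} refl = cong (x ,_) (Decidable⇒UIP.≡-irrelevant _≟_ p q)

  labelOf : ∀ {k} (ℓ : Labeling C k) {v} → Fiber C v → Fin k
  labelOf ℓ {v} = to⁻ (ℓ v)

  at-labelOf : ∀ {k} (ℓ : Labeling C k) {v} (a : Fiber C v) → at C ℓ v (labelOf ℓ a) ≡ proj₁ a
  at-labelOf ℓ {v} a = cong proj₁ (to∘to⁻ (ℓ v) a)

  neighbour-label-unique : ∀ {k} (ℓ : Labeling C k) {u v x i j} → Adj G u v → part C x ≡ u →
                           AdjH x (at C ℓ v i) → AdjH x (at C ℓ v j) → i ≡ j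
  neighbour-label-unique ℓ {u} {v} {x} {i} {j} a px h h′ =
    at-injective ℓ v (matching C x _ _ apart (trans (part-at ℓ v i) (sym (part-at ℓ v j))) h h′)
    where
      apart : part C x ≢ part C (at C ℓ v i)
      apart e = irrefl G (subst (Adj G u) (sym (trans (sym px) (trans e (part-at ℓ v i)))) a)

  crossed⇒¬adj : ∀ ℓ {u v} → Adj G u v → Crossed ℓ u v → ∀ j → ¬ AdjH (at C ℓ u j) (at C ℓ v j)
  crossed⇒¬adj ℓ {u} a cr j h = opposite-≢ j (neighbour-label-unique ℓ a (part-at ℓ u j) h (cr j))

  rebase : ∀ {k} → Labeling C (suc k) → ((v : Fin n) → Fiber C v) → Labeling C (suc k)
  rebase ℓ b v = ℓ v ⤖-∘ ↔⇒⤖ (transpose 0F (labelOf ℓ (b v)))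

  at-rebase : ∀ {k} (ℓ : Labeling C (suc k)) b v → at C (rebase ℓ b) v 0F ≡ proj₁ (b v)
  at-rebase ℓ b v = at-labelOf ℓ (b v)

  module _ (ℓ ℓ′ : Labeling C 2) where

    offset : Fin n → Fin 2
    offset x = labelOf ℓ (to (ℓ′ x) 0F)

    at-offset : ∀ x → at C ℓ x (offset x) ≡ at C ℓ′ x 0F
    at-offset x = at-labelOf ℓ (to (ℓ′ x) 0F)

    offset-adj : ∀ {x y} → Straight ℓ′ x y → AdjH (at C ℓ x (offset x)) (at C ℓ y (offset y))
    offset-adj st′ = subst₂ AdjH (sym (at-offset _)) (sym (at-offset _)) (st′ 0F)

    offset-straight : ∀ {x y} → Adj G x y → Straight ℓ′ x y → Straight ℓ x y → offset x ≡ offset y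
    offset-straight {x} a st′ st =
      neighbour-label-unique ℓ a (part-at ℓ x (offset x)) (st (offset x)) (offset-adj st′)

    offset-crossed : ∀ {x y} → Adj G x y → Straight ℓ′ x y → Crossed ℓ x y →
                     opposite (offset x) ≡ offset y
    offset-crossed {x} a st′ cr =
      neighbour-label-unique ℓ a (part-at ℓ x (offset x)) (cr (offset x)) (offset-adj st′)

  module _ (full : IsFull C) where

    neighbour : ∀ {u v} → Adj G u v → Fiber C u → Fiber C v
    neighbour {u} {v} a (x , px) = proj₁ (full u v a x px) , proj₁ (proj₂ (full u v a x px))

    neighbour-adj : ∀ {u v} (a : Adj G u v) e → AdjH (proj₁ e) (proj₁ (neighbour a e))
    neighbour-adj {u} {v} a (x , px) = proj₂ (proj₂ (full u v a x px))

    straight⊎crossed : ∀ (ℓ : Labeling C 2) {u v} → Adj G u v → Straight ℓ u v ⊎ Crossed ℓ u v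
    straight⊎crossed ℓ {u} {v} a = classify (injective-Fin2 τ τ-injective)
      where
        τ : Fin 2 → Fin 2
        τ j = labelOf ℓ (neighbour a (to (ℓ u) j))
        τ-adj : ∀ j → AdjH (at C ℓ u j) (at C ℓ v (τ j))
        τ-adj j = subst (AdjH _) (sym (at-labelOf ℓ _)) (neighbour-adj a _)
        τ-injective : τ 0F ≢ τ 1F
        τ-injective e = 0≢1+n (neighbour-label-unique ℓ (Graph.sym G a) (part-at ℓ v _)
          (Graph.sym (H C) (τ-adj 0F))
          (subst (λ i → AdjH (at C ℓ v i) (at C ℓ u 1F)) (sym e)
            (Graph.sym (H C) (τ-adj 1F))))
        τ-adj-at : ∀ {f : Fin 2 → Fin 2} → (∀ j → τ j ≡ f j) →
                   ∀ j → AdjH (at C ℓ u j) (at C ℓ v (f j))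
        τ-adj-at τ≗f j = subst (λ i → AdjH (at C ℓ u j) (at C ℓ v i)) (τ≗f j) (τ-adj j)
        classify : (∀ j → τ j ≡ j) ⊎ (∀ j → τ j ≡ opposite j) → Straight ℓ u v ⊎ Crossed ℓ u v
        classify (inj₁ τ≗id) = inj₁ (τ-adj-at τ≗id)
        classify (inj₂ τ≗opposite) = inj₂ (τ-adj-at τ≗opposite)

    adj-zero⇒straight : ∀ ℓ {u v} → Adj G u v → AdjH (at C ℓ u 0F) (at C ℓ v 0F) → Straight ℓ u v
    adj-zero⇒straight ℓ a h with straight⊎crossed ℓ a
    ... | inj₁ st = st
    ... | inj₂ cr = ⊥-elim (crossed⇒¬adj ℓ a cr 0F h)

    ¬adj⇒crossed : ∀ ℓ {u v l} → Adj G u v → ¬ AdjH (at C ℓ u l) (at C ℓ v l) → Crossed ℓ u v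
    ¬adj⇒crossed ℓ {l = l} a ¬h with straight⊎crossed ℓ a
    ... | inj₁ st = ⊥-elim (¬h (st l))
    ... | inj₂ cr = cr

module CycleCover {n : ℕ} {G : Graph (suc n)} (σ : Fin (suc n) ⤖ Fin (suc n))
  (iso : ∀ u v → Adj G u v ⇔ CycAdj (suc n) (to σ u) (to σ v)) (C : Cover G) where

  open CycleOrder G σ iso
  open CoverLabelling C

  private
    AdjH = Adj (H C)

  succ-edge-other : 2 ≤ n → ∀ {x u} → x ≢ u → ¬ SameEdge x (succ x) u (succ u)
  succ-edge-other 2≤n x≢u (inj₁ (x≡u , _)) = x≢u x≡u
  succ-edge-other 2≤n {u = u} x≢u (inj₂ (x≡su , sx≡u)) =
    succ∘succ≢id 2≤n u (trans (cong succ (sym x≡su)) sx≡u)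

  one-crossing⇒¬canonical : (ℓ : Labeling C 2) (u : Fin (suc n)) →
    (∀ x → x ≢ u → Straight ℓ x (succ x)) → Crossed ℓ u (succ u) → ¬ HasCanonicalLabeling C 2
  one-crossing⇒¬canonical ℓ u st cr (ℓ′ , can) =
    opposite-≢ (offset ℓ ℓ′ u) (trans constant (sym flipped))
    where
      constant : offset ℓ ℓ′ u ≡ offset ℓ ℓ′ (succ u)
      constant = succ-cut (offset ℓ ℓ′) u λ x x≢u →
        offset-straight ℓ ℓ′ (succ-adj x) (can x (succ x) (succ-adj x)) (st x x≢u)
      flipped : opposite (offset ℓ ℓ′ u) ≡ offset ℓ ℓ′ (succ u)
      flipped = offset-crossed ℓ ℓ′ (succ-adj u) (can u (succ u) (succ-adj u)) cr

  twisted⇒¬canonical : 2 ≤ n → HasTwistedCanonicalLabeling C 2 → ¬ HasCanonicalLabeling C 2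
  twisted⇒¬canonical 2≤n (full , ℓ , u , v , a , st , l , ¬h) with adj⇒succ a
  ... | inj₁ refl = one-crossing⇒¬canonical ℓ u
        (λ x x≢u → st x (succ x) (succ-adj x) (succ-edge-other 2≤n x≢u))
        (¬adj⇒crossed full ℓ (succ-adj u) ¬h)
  ... | inj₂ refl = one-crossing⇒¬canonical ℓ v
        (λ x x≢v → st x (succ x) (succ-adj x) (λ s → succ-edge-other 2≤n x≢v (SameEdge-symʳ s)))
        (¬adj⇒crossed full ℓ (succ-adj v) (λ h → ¬h (Graph.sym (H C) h)))

  module PathLift (full : IsFull C) (ℓ₀ : Labeling C 2) where

    lift : (k : ℕ) → Fiber C (walk k)
    lift zero = to (ℓ₀ (walk zero)) 0F
    lift (suc k) = neighbour full (succ-adj (walk k)) (lift k)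

    ℓ : Labeling C 2
    ℓ = rebase ℓ₀ λ v → proj₁ (lift (pos v)) , trans (proj₂ (lift (pos v))) (walk-pos v)

    at-ℓ-zero : ∀ v → at C ℓ v 0F ≡ proj₁ (lift (pos v))
    at-ℓ-zero = at-rebase ℓ₀ _

    last : Fin (suc n)
    last = walk n

    straight-succ : ∀ x → x ≢ last → Straight ℓ x (succ x)
    straight-succ x x≢last = adj-zero⇒straight full ℓ (succ-adj x)
      (subst₂ AdjH (sym (at-ℓ-zero x)) (sym (at-ℓ-zero (succ x))) lifted-adj)
      where
        x<n : pos x < n
        x<n with m≤n⇒m<n∨m≡n (pos≤n x)
        ... | inj₁ lt = lt
        ... | inj₂ e = ⊥-elim (x≢last (trans (sym (walk-pos x)) (cong walk e)))
        lifted-adj : AdjH (proj₁ (lift (pos x))) (proj₁ (lift (pos (succ x))))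
        lifted-adj = subst (λ k → AdjH (proj₁ (lift (pos x))) (proj₁ (lift k))) (sym (pos-succ x<n))
                       (neighbour-adj full (succ-adj (walk (pos x))) (lift (pos x)))

  full∧¬canonical⇒twisted : IsKFold C 2 → IsFull C → ¬ HasCanonicalLabeling C 2 →
                            HasTwistedCanonicalLabeling C 2
  full∧¬canonical⇒twisted ℓ₀ full ¬can =
    full , ℓ , last , succ last , succ-adj last ,
    (λ x y → adj-by-succ OffLast OffLast-sym OffLast-succ) , 0F , ¬adj-last
    where
      open PathLift full ℓ₀
      OffLast : Fin (suc n) → Fin (suc n) → Set
      OffLast x y = ¬ SameEdge x y last (succ last) → Straight ℓ x y
      OffLast-sym : ∀ {x y} → OffLast x y → OffLast y x
      OffLast-sym off ¬same = Straight-sym ℓ (off (λ same → ¬same (SameEdge-symˡ same)))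
      OffLast-succ : ∀ x → OffLast x (succ x)
      OffLast-succ x ¬same = straight-succ x (λ x≡last → ¬same (inj₁ (x≡last , cong succ x≡last)))
      ¬adj-last : ¬ AdjH (at C ℓ last 0F) (at C ℓ (succ last) 0F)
      ¬adj-last h = ¬can (ℓ , λ x y → adj-by-succ (Straight ℓ) (Straight-sym ℓ) straight)
        where
          straight : ∀ x → Straight ℓ x (succ x)
          straight x with x ≟ last
          ... | yes refl = adj-zero⇒straight full ℓ (succ-adj last) h
          ... | no x≢last = straight-succ x x≢last

lemma14 : ∀ {n : ℕ} (G : Graph n) → IsCycle G → (C : Cover G) → IsKFold C 2 →
          HasTwistedCanonicalLabeling C 2 ⇔ (IsFull C × ¬ HasCanonicalLabeling C 2)
lemma14 G (s≤s 2≤n , σ , iso) C ℓ₀ = mk⇔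
  (λ twisted → proj₁ twisted , twisted⇒¬canonical 2≤n twisted)
  (λ (full , ¬can) → full∧¬canonical⇒twisted ℓ₀ full ¬can)
  where open CycleCover σ iso C
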